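{- Let $H$ be a graph, and let the sets $A$ and $B$ partition $V(H)$. Let $a\in A$ and $b\in B$ be such that every edge of $H$ between $A$ and $B$ is incident with $a$, and $b$ is a neighbor of $a$. Let $h\geq 3$ and $t\geq 1$ be integers. Then $H$ has an $(h,t)$-tree layout if and only if the two graphs $H_A=H[A\cup\{b\}]$ and $H_B=H[B\cup\{a\}]$ both have $(h,t)$-tree layouts.
   Context: Graphs are finite and simple; $H[Y]$ denotes the subgraph induced by $Y$. For a tree $T$, $\mathcal{L}(T)$ is its set of leaves (vertices of degree at most $1$). For integers $h\geq 3$ and $t\geq 1$, an $(h,t)$-tree layout of a graph $H$ is a tree $T$ of maximum degree at most $h$ with $V(H)=\mathcal{L}(T)$ (the vertices of $H$ are exactly the leaves of $T$) such that, for every two independent (vertex-disjoint) edges $xy$ and $x'y'$ of $H$, the path in $T$ between $x$ and $y$ and the path in $T$ between $x'$ and $y'$ share at most $t-1$ vertices. -}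

module Defs where

open import Data.Nat using (ℕ; _≤_; _∸_; _≥_)
open import Data.Bool using (Bool; true; false; T)
open import Data.Fin using (Fin; _≟_)
open import Data.List using (List; []; _∷_; length; filter; filterᵇ; allFin)
open import Data.List.Relation.Unary.Unique.Propositional using (Unique)
import Data.List.Membership.DecPropositional as DecMem
open import Data.List.Membership.Propositional using ()
open import Data.Product using (Σ; ∃; _×_; _,_)
open import Data.Empty using (⊥)
open import Relation.Binary.PropositionalEquality using (_≡_; _≢_)
open import Relation.Nullary using (¬_)
open import Function.Definitions using (Injective)

record Graph (V : Set) : Set₁ where
  field
    E      : V → V → Set
    E-sym  : ∀ {x y} → E x y → E y x
    E-irr  : ∀ {x} → ¬ E x x

open Graph public

induced : ∀ {V : Set} → Graph V → (Y : V → Bool) → Graph (Σ V (λ v → T (Y v)))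
induced H Y = record
  { E     = λ u w → E H (Data.Product.proj₁ u) (Data.Product.proj₁ w)
  ; E-sym = λ e → E-sym H e
  ; E-irr = λ e → E-irr H e
  }

record FinGraph (m : ℕ) : Set where
  field
    adj     : Fin m → Fin m → Bool
    adj-sym : ∀ x y → adj x y ≡ adj y x
    adj-irr : ∀ x → adj x x ≡ false

open FinGraph public

module _ {m : ℕ} (G : FinGraph m) where

  data Walk : Fin m → Fin m → List (Fin m) → Set where
    here : ∀ {x} → Walk x x (x ∷ [])
    step : ∀ {x y z p} → adj G x y ≡ true → Walk y z p → Walk x z (x ∷ p)

  IsPath : Fin m → Fin m → List (Fin m) → Set
  IsPath x y p = Walk x y p × Unique p

  Connected : Set
  Connected = ∀ x y → ∃ λ p → Walk x y p

  Acyclic : Set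
  Acyclic = ∀ x y p → IsPath x y p → length p ≥ 3 → adj G y x ≡ true → ⊥

  IsTree : Set
  IsTree = Connected × Acyclic

  degree : Fin m → ℕ
  degree v = length (filterᵇ (adj G v) (allFin m))

  IsLeaf : Fin m → Set
  IsLeaf v = degree v ≤ 1

shared : ∀ {m} → List (Fin m) → List (Fin m) → ℕ
shared {m} p q = length (filter (λ v → v ∈? q) p)
  where open DecMem (_≟_ {m}) using (_∈?_)

record TreeLayout (h t : ℕ) {V : Set} (H : Graph V) : Set₁ where
  field
    m       : ℕ
    tree    : FinGraph m
    isTree  : IsTree tree
    maxDeg  : ∀ v → degree tree v ≤ h
    -- identification of V(H) with the set of leaves of T
    f       : V → Fin m
    f-inj   : Injective _≡_ _≡_ f
    f-leaf  : ∀ v → IsLeaf tree (f v)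
    f-onto  : ∀ u → IsLeaf tree u → ∃ λ v → f v ≡ u
    layout  : ∀ x y x′ y′ → E H x y → E H x′ y′ →
              x ≢ x′ → x ≢ y′ → y ≢ x′ → y ≢ y′ →
              ∀ p q → IsPath tree (f x) (f y) p → IsPath tree (f x′) (f y′) q →
              shared p q ≤ t ∸ 1

HasTreeLayout : (h t : ℕ) {V : Set} → Graph V → Set₁
HasTreeLayout h t H = TreeLayout h t H

module Submission where

-- (⇒) A layout restricts to every induced subgraph: keep the tree and the leaf
-- map, then delete, one at a time, leaves that are no longer images of vertices.
-- Deleting a leaf keeps a tree, lowers no degree, and maps paths injectively to
-- paths of the old tree, so shared vertex counts are unchanged (restrict).
-- (⇐) Join the tree of H_A and the tree of H_B by a new edge between the leaf of b
-- and the leaf of a (module Glue).  Degrees grow only at these two leaves, which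
-- stop being leaves, so the leaves are exactly the vertices of H.  A path between
-- the ends of an edge xy of H splits into a part in each tree; a part is empty or
-- the path between the ends of the projected edge, where the projection sends B to b
-- on the A-side and A to a on the B-side (module SidePart).  Projections keep
-- independent edges independent, so each side shares at most t − 1 vertices, and
-- two independent edges cannot both cross between A and B, so one side shares none
-- (module Gluing).

open import Defs
open import Data.Nat using (ℕ; zero; suc; _+_; _≤_; _∸_; _≥_; z≤n; s≤s; _≤?_)
open import Data.Nat.Properties using (≤-trans; m≤n+m; +-monoʳ-≤; +-assoc; +-identityʳ; +-comm; +-monoˡ-≤)
open import Data.Bool using (Bool; true; false; not; _∨_; _∧_; T; if_then_else_) renaming (_≟_ to _≟ᵇ_)
open import Data.Bool.Properties using (T-irrelevant; ∧-comm; T-∨; T-≡; T-not-≡)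
open import Data.Fin using (Fin; zero; suc; _≟_; punchIn; punchOut; _↑ˡ_; _↑ʳ_; splitAt; join)
open import Data.Fin.Properties using (punchIn-injective; punchInᵢ≢i; punchIn-punchOut; any?; ↑ˡ-injective; ↑ʳ-injective; splitAt-↑ˡ; splitAt-↑ʳ; join-splitAt)
open import Data.List using (List; []; _∷_; length; filter; filterᵇ; tabulate; map; _++_)
open import Data.List.Properties using (length-map; length-++; filter-++; ++-identityʳ)
open import Data.List.Relation.Unary.Unique.Propositional using (Unique)
import Data.List.Relation.Unary.Unique.Propositional.Properties as Unique
open import Data.List.Relation.Unary.AllPairs using ([]; _∷_)
import Data.List.Relation.Unary.All as All
import Data.List.Relation.Unary.All.Properties as All
open import Data.List.Membership.Propositional using (_∈_)
open import Data.List.Membership.Propositional.Properties using (∈-map⁺; ∈-map⁻; ∈-++⁺ˡ; ∈-++⁺ʳ; ∈-++⁻)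
import Data.List.Membership.DecPropositional as DecMembership
open import Data.List.Relation.Unary.Any using (here; there)
open import Data.Product using (Σ; ∃; ∃₂; _×_; _,_; proj₁; proj₂)
open import Data.Sum using (_⊎_; inj₁; inj₂; [_,_]′; swap) renaming (map to ⊎-map)
open import Data.Empty using (⊥-elim)
open import Data.Unit using (tt)
open import Relation.Binary.PropositionalEquality
open ≡-Reasoning
open import Relation.Nullary using (¬_; Dec; yes; no; does; ¬?; _×-dec_)
open import Relation.Nullary.Decidable using (⌊_⌋; decidable-stable; map′; dec-true; toWitness; fromWitness)
open import Relation.Unary using (Decidable)
open import Function using (_∘_; id)
open import Function.Definitions using (Injective)
open import Function.Bundles using (_⇔_; mk⇔; Equivalence)

bit : Bool → ℕ
bit true  = 1
bit false = 0

count : ∀ {m} → (Fin m → Bool) → ℕ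
count {zero}  P = 0
count {suc m} P = bit (P zero) + count (P ∘ suc)

count-filter : ∀ {A : Set} {m} (P : A → Bool) (g : Fin m → A) →
  length (filterᵇ P (tabulate g)) ≡ count (P ∘ g)
count-filter {m = zero}  P g = refl
count-filter {m = suc m} P g with P (g zero)
... | true  = cong suc (count-filter P (g ∘ suc))
... | false = count-filter P (g ∘ suc)

degree-count : ∀ {m} (G : FinGraph m) v → degree G v ≡ count (adj G v)
degree-count G v = count-filter (adj G v) id

count-cong : ∀ {m} {P Q : Fin m → Bool} → (∀ x → P x ≡ Q x) → count P ≡ count Q
count-cong {zero}  P≗Q = refl
count-cong {suc m} P≗Q = cong₂ _+_ (cong bit (P≗Q zero)) (count-cong (P≗Q ∘ suc))

count-punchIn : ∀ {k} (P : Fin (suc k) → Bool) u → count (P ∘ punchIn u) ≤ count P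
count-punchIn         P zero    = m≤n+m _ _
count-punchIn {suc k} P (suc u) = +-monoʳ-≤ (bit (P zero)) (count-punchIn (P ∘ suc) u)

count-≥1 : ∀ {m} (P : Fin m → Bool) {x} → P x ≡ true → 1 ≤ count P
count-≥1 P {zero} Px rewrite Px = s≤s z≤n
count-≥1 {suc m} P {suc x} Px = ≤-trans (count-≥1 (P ∘ suc) Px) (m≤n+m _ _)

count-≥2 : ∀ {m} (P : Fin m → Bool) {x y} → x ≢ y → P x ≡ true → P y ≡ true → 2 ≤ count P
count-≥2 P {zero}  {zero}  x≢y _  _  = ⊥-elim (x≢y refl)
count-≥2 P {zero}  {suc y} _   Px Py rewrite Px = s≤s (count-≥1 (P ∘ suc) Py)
count-≥2 P {suc x} {zero}  _   Px Py rewrite Py = s≤s (count-≥1 (P ∘ suc) Px)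
count-≥2 {suc m} P {suc x} {suc y} x≢y Px Py =
  ≤-trans (count-≥2 (P ∘ suc) (x≢y ∘ cong suc) Px Py) (m≤n+m _ _)

count-↑ : ∀ {m n} (P : Fin (m + n) → Bool) →
  count P ≡ count (λ i → P (i ↑ˡ n)) + count (λ j → P (m ↑ʳ j))
count-↑ {zero}      P = refl
count-↑ {suc m} {n} P = trans (cong (bit (P zero) +_) (count-↑ {m} {n} (P ∘ suc)))
                              (sym (+-assoc (bit (P zero)) _ _))

count-false : ∀ {m} → count {m} (λ _ → false) ≡ 0
count-false {zero}  = refl
count-false {suc m} = count-false {m}

count-point : ∀ {m} (c : Fin m) (β : Bool) → count (λ j → does (j ≟ c) ∧ β) ≡ bit β
count-point {suc m} zero    β = trans (cong (bit β +_) (count-false {m})) (+-identityʳ (bit β))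
count-point {suc m} (suc c) β = count-point c β

leaf-neighbour-unique : ∀ {m} (G : FinGraph m) {u x y} → IsLeaf G u →
  adj G u x ≡ true → adj G u y ≡ true → x ≡ y
leaf-neighbour-unique G {u} {x} {y} leaf ux uy with x ≟ y
... | yes x≡y = x≡y
... | no  x≢y with ≤-trans (subst (2 ≤_) (sym (degree-count G u)) (count-≥2 (adj G u) x≢y ux uy)) leaf
...   | s≤s ()

degree-≥1 : ∀ {m} (G : FinGraph m) {v u} → adj G v u ≡ true → 1 ≤ degree G v
degree-≥1 G {v} vu = subst (1 ≤_) (sym (degree-count G v)) (count-≥1 (adj G v) vu)

sum-bound : ∀ {m n k} → m ≤ k → n ≤ k → m ≡ 0 ⊎ n ≡ 0 → m + n ≤ k
sum-bound     _   n≤k (inj₁ refl) = n≤k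
sum-bound {m} m≤k _   (inj₂ refl) = subst (_≤ _) (sym (+-identityʳ m)) m≤k

walk-map : ∀ {k m} {G : FinGraph k} {G′ : FinGraph m} (ι : Fin k → Fin m) →
  (∀ {x y} → adj G x y ≡ true → adj G′ (ι x) (ι y) ≡ true) →
  ∀ {x y p} → Walk G x y p → Walk G′ (ι x) (ι y) (map ι p)
walk-map ι hom here       = here
walk-map ι hom (step e w) = step (hom e) (walk-map ι hom w)

walk-start : ∀ {m} {G : FinGraph m} {x y p} → Walk G x y p → x ∈ p
walk-start here       = here refl
walk-start (step _ _) = here refl

walk-end : ∀ {m} {G : FinGraph m} {x y p} → Walk G x y p → y ∈ p
walk-end here       = here refl
walk-end (step _ w) = there (walk-end w)

path-closed : ∀ {m} {G : FinGraph m} {x p} → IsPath G x x p → p ≡ x ∷ []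
path-closed (here     , _)       = refl
path-closed (step _ w , x∉ ∷ _) = ⊥-elim (All.lookup x∉ (walk-end w) refl)

walk-join : ∀ {m} {G : FinGraph m} {x y z w p q} →
  Walk G x y p → adj G y z ≡ true → Walk G z w q → Walk G x w (p ++ q)
walk-join here        yz w₂ = step yz w₂
walk-join (step e w₁) yz w₂ = step e (walk-join w₁ yz w₂)

has-neighbour : ∀ {m} {G : FinGraph m} → Connected G → ∀ {x y} → x ≢ y → ∃ λ z → adj G x z ≡ true
has-neighbour conn {x} {y} x≢y with conn x y
... | _ , here     = ⊥-elim (x≢y refl)
... | _ , step e _ = _ , e

unique-++ˡ : ∀ {A : Set} (xs : List A) {ys} → Unique (xs ++ ys) → Unique xs
unique-++ˡ []       u         = []
unique-++ˡ (x ∷ xs) (x∉ ∷ u) = All.++⁻ˡ xs x∉ ∷ unique-++ˡ xs u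

unique-++ʳ : ∀ {A : Set} (xs : List A) {ys} → Unique (xs ++ ys) → Unique ys
unique-++ʳ []       u       = u
unique-++ʳ (x ∷ xs) (_ ∷ u) = unique-++ʳ xs u

module _ {m : ℕ} where
  open DecMembership (_≟_ {m}) using (_∈?_)

  shared-++ : (p p′ q : List (Fin m)) → shared (p ++ p′) q ≡ shared p q + shared p′ q
  shared-++ p p′ q = trans (cong length (filter-++ (_∈? q) p p′)) (length-++ (filter (_∈? q) p))

  shared-[]ʳ : (p : List (Fin m)) → shared p [] ≡ 0
  shared-[]ʳ []      = refl
  shared-[]ʳ (z ∷ p) = shared-[]ʳ p

  shared-empty : {p q : List (Fin m)} → p ≡ [] ⊎ q ≡ [] → shared p q ≡ 0
  shared-empty (inj₁ refl)      = refl
  shared-empty {p} (inj₂ refl) = shared-[]ʳ p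

shared-map : ∀ {k m} (ι : Fin k → Fin m) (p q : List (Fin k)) (q′ : List (Fin m)) →
  (∀ x → ι x ∈ q′ ⇔ x ∈ q) → shared (map ι p) q′ ≡ shared p q
shared-map         ι []      q q′ corr = refl
shared-map {k} {m} ι (x ∷ p) q q′ corr
  with DecMembership._∈?_ (_≟_ {m}) (ι x) q′ | DecMembership._∈?_ (_≟_ {k}) x q
... | yes _  | yes _  = cong suc (shared-map ι p q q′ corr)
... | no  _  | no  _  = shared-map ι p q q′ corr
... | yes ι∈ | no x∉ = ⊥-elim (x∉ (Equivalence.to (corr x) ι∈))
... | no ι∉ | yes x∈ = ⊥-elim (ι∉ (Equivalence.from (corr x) x∈))

∈-map-injective : ∀ {A B : Set} {f : A → B} → Injective _≡_ _≡_ f →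
  ∀ {x xs} → f x ∈ map f xs ⇔ x ∈ xs
∈-map-injective {f = f} f-inj = mk⇔ from (∈-map⁺ f)
  where from : ∀ {x xs} → f x ∈ map f xs → x ∈ xs
        from fx∈ with ∈-map⁻ f fx∈
        ... | _ , y∈ , fx≡fy rewrite f-inj fx≡fy = y∈

∈-blocks : ∀ {A B C : Set} {ι : A → C} {κ : B → C} → Injective _≡_ _≡_ ι →
  (∀ x y → ι x ≢ κ y) → ∀ {x xs ys} →
  (ι x ∈ map ι xs ++ map κ ys ⇔ x ∈ xs) × (ι x ∈ map κ ys ++ map ι xs ⇔ x ∈ xs)
∈-blocks {ι = ι} {κ} ι-inj disjoint {x} {xs} {ys} =
    mk⇔ (λ x∈ → [ from-ι , from-κ ]′ (∈-++⁻ (map ι xs) x∈)) (∈-++⁺ˡ ∘ to-ι)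
  , mk⇔ (λ x∈ → [ from-κ , from-ι ]′ (∈-++⁻ (map κ ys) x∈)) (∈-++⁺ʳ (map κ ys) ∘ to-ι)
  where
    open Equivalence (∈-map-injective ι-inj {x} {xs}) renaming (to to from-ι; from to to-ι)
    from-κ : ι x ∈ map κ ys → x ∈ xs
    from-κ ιx∈ with ∈-map⁻ κ ιx∈
    ... | y , _ , ιx≡κy = ⊥-elim (disjoint x y ιx≡κy)

Separated : (t : ℕ) {V : Set} → Graph V → ∀ {m} → FinGraph m → (V → Fin m) → Set
Separated t H T f = ∀ x y x′ y′ → E H x y → E H x′ y′ →
  x ≢ x′ → x ≢ y′ → y ≢ x′ → y ≢ y′ →
  ∀ p q → IsPath T (f x) (f y) p → IsPath T (f x′) (f y′) q → shared p q ≤ t ∸ 1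

-- A tree layout, except that T may have leaves that are not vertices of H.
record PartialLayout (h t : ℕ) {V : Set} (H : Graph V) (m : ℕ) : Set₁ where
  field
    tree   : FinGraph m
    isTree : IsTree tree
    maxDeg : ∀ v → degree tree v ≤ h
    f      : V → Fin m
    f-inj  : Injective _≡_ _≡_ f
    f-leaf : ∀ v → IsLeaf tree (f v)
    layout : Separated t H tree f

module LeafDeletion {k : ℕ} (T : FinGraph (suc k)) (u : Fin (suc k)) (u-leaf : IsLeaf T u) where

  ι : Fin k → Fin (suc k)
  ι = punchIn u

  ι-injective : Injective _≡_ _≡_ ι
  ι-injective = punchIn-injective u _ _

  T⁻ : FinGraph k
  T⁻ = record { adj     = λ x y → adj T (ι x) (ι y)
              ; adj-sym = λ x y → adj-sym T (ι x) (ι y)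
              ; adj-irr = λ x → adj-irr T (ι x) }

  lift-path : ∀ {x y p} → IsPath T⁻ x y p → IsPath T (ι x) (ι y) (map ι p)
  lift-path (w , u) = walk-map ι id w , Unique.map⁺ ι-injective u

  -- A walk of T between vertices other than u can skip u: it can only enter u
  -- from its unique neighbour and must return to it.
  lower : ∀ {x y p} → Walk T x y p → ∀ {x′ y′} → x ≡ ι x′ → y ≡ ι y′ → ∃ (Walk T⁻ x′ y′)
  lower here x≡ y≡ with ι-injective (trans (sym x≡) y≡)
  ... | refl = _ , here
  lower (step {y = z} xz w) x≡ y≡ with u ≟ z
  ... | no u≢z =
    let z≡ = sym (punchIn-punchOut u≢z)
        (_ , w⁻) = lower w z≡ y≡
    in _ , step (subst₂ (λ s r → adj T s r ≡ true) x≡ z≡ xz) w⁻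
  lower (step xz here) x≡ y≡ | yes refl = ⊥-elim (punchInᵢ≢i u _ (sym y≡))
  lower {x} (step xz (step uz w)) x≡ y≡ | yes refl
    with leaf-neighbour-unique T u-leaf (trans (adj-sym T u x) xz) uz
  ... | refl = lower w x≡ y≡

  isTree⁻ : IsTree T → IsTree T⁻
  isTree⁻ (conn , acyc) =
      (λ x y → lower (proj₂ (conn (ι x) (ι y))) refl refl)
    , (λ x y p path len yx → acyc (ι x) (ι y) (map ι p) (lift-path path)
                                (subst (_≥ 3) (sym (length-map ι p)) len) yx)

  degree⁻ : ∀ x → degree T⁻ x ≤ degree T (ι x)
  degree⁻ x rewrite degree-count T⁻ x | degree-count T (ι x) = count-punchIn (adj T (ι x)) u

module _ {h t : ℕ} {V : Set} {H : Graph V} where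

  UnusedLeaf : ∀ {m} → PartialLayout h t H m → Fin m → Set
  UnusedLeaf P u = IsLeaf tree u × ¬ (∃ λ v → f v ≡ u)
    where open PartialLayout P

  delete-unused : ∀ {k} (P : PartialLayout h t H (suc k)) u → UnusedLeaf P u → PartialLayout h t H k
  delete-unused P u (u-leaf , unused) = record
    { tree   = T⁻
    ; isTree = isTree⁻ isTree
    ; maxDeg = λ x → ≤-trans (degree⁻ x) (maxDeg (ι x))
    ; f      = f⁻
    ; f-inj  = λ {v} {w} e → f-inj (trans (sym (ι-f⁻ v)) (trans (cong ι e) (ι-f⁻ w)))
    ; f-leaf = λ v → ≤-trans (degree⁻ (f⁻ v)) (subst (IsLeaf tree) (sym (ι-f⁻ v)) (f-leaf v))
    ; layout = λ x y x′ y′ e e′ d₁ d₂ d₃ d₄ p q path path′ →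
        subst (_≤ t ∸ 1) (shared-map ι p q (map ι q) (λ _ → ∈-map-injective ι-injective))
          (layout x y x′ y′ e e′ d₁ d₂ d₃ d₄ (map ι p) (map ι q)
                  (lift-image path) (lift-image path′))
    }
    where
      open PartialLayout P
      open LeafDeletion tree u u-leaf
      f⁻ : V → Fin _
      f⁻ v = punchOut (λ u≡fv → unused (v , sym u≡fv))
      ι-f⁻ : ∀ v → ι (f⁻ v) ≡ f v
      ι-f⁻ v = punchIn-punchOut _
      lift-image : ∀ {x y p} → IsPath T⁻ (f⁻ x) (f⁻ y) p → IsPath tree (f x) (f y) (map ι p)
      lift-image {x} {y} {p} path =
        subst₂ (λ s r → IsPath tree s r (map ι p)) (ι-f⁻ x) (ι-f⁻ y) (lift-path path)

Searchable : Set → Set₁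
Searchable V = ∀ (P : V → Set) → Decidable P → Dec (∃ P)

searchable-Fin : ∀ {n} → Searchable (Fin n)
searchable-Fin P P? = any? P?

searchable-subtype : ∀ {V} → Searchable V → (Y : V → Bool) → Searchable (Σ V (T ∘ Y))
searchable-subtype search Y P P? =
  map′ (λ (v , y , Pv) → (v , y) , Pv) (λ ((v , y) , Pv) → v , y , Pv)
       (search (λ v → Σ (T (Y v)) λ y → P (v , y)) (λ v → fibre? v (Y v) refl))
  where
    fibre? : ∀ v b → Y v ≡ b → Dec (Σ (T (Y v)) λ y → P (v , y))
    fibre? v true  Yv = let y = subst T (sym Yv) tt in
      map′ (y ,_) (λ (y′ , Py′) → subst (λ z → P (v , z)) (T-irrelevant y′ y) Py′) (P? (v , y))
    fibre? v false Yv = no (λ (y , _) → subst T Yv y)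

module Completion {h t : ℕ} {V : Set} {H : Graph V} (search : Searchable V) where

  image? : ∀ {m} (P : PartialLayout h t H m) u → Dec (∃ λ v → PartialLayout.f P v ≡ u)
  image? P u = search (λ v → f v ≡ u) (λ v → f v ≟ u)
    where open PartialLayout P

  unused-leaf? : ∀ {m} (P : PartialLayout h t H m) → Decidable (UnusedLeaf P)
  unused-leaf? P u = (degree (PartialLayout.tree P) u ≤? 1) ×-dec ¬? (image? P u)

  complete : ∀ {m} → PartialLayout h t H m → TreeLayout h t H
  complete P with any? (unused-leaf? P)
  complete {suc m} P | yes (u , unused) = complete (delete-unused P u unused)
  complete P | no none = record
    { tree = tree ; isTree = isTree ; maxDeg = maxDeg ; f = f ; f-inj = f-inj
    ; f-leaf = f-leaf ; layout = layout
    ; f-onto = λ u leaf → decidable-stable (image? P u) (λ unused → none (u , leaf , unused)) }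
    where open PartialLayout P

subtype-≡ : ∀ {V : Set} {Y : V → Bool} {u w : Σ V (T ∘ Y)} → proj₁ u ≡ proj₁ w → u ≡ w
subtype-≡ {u = v , y} {.v , y′} refl = cong (v ,_) (T-irrelevant y y′)

restrict : ∀ {h t} {V : Set} {H : Graph V} → Searchable V → (Y : V → Bool) →
  TreeLayout h t H → TreeLayout h t (induced H Y)
restrict search Y L = Completion.complete (searchable-subtype search Y) (record
  { tree = tree ; isTree = isTree ; maxDeg = maxDeg
  ; f      = f ∘ proj₁
  ; f-inj  = λ e → subtype-≡ (f-inj e)
  ; f-leaf = f-leaf ∘ proj₁
  ; layout = λ x y x′ y′ e e′ d₁ d₂ d₃ d₄ →
      layout (proj₁ x) (proj₁ y) (proj₁ x′) (proj₁ y′) e e′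
             (d₁ ∘ subtype-≡) (d₂ ∘ subtype-≡) (d₃ ∘ subtype-≡) (d₄ ∘ subtype-≡) })
  where open TreeLayout L

module Glue {mA mB : ℕ} (TA : FinGraph mA) (TB : FinGraph mB) (bA : Fin mA) (aB : Fin mB) where

  inl : Fin mA → Fin (mA + mB)
  inl i = i ↑ˡ mB

  inr : Fin mB → Fin (mA + mB)
  inr j = mA ↑ʳ j

  inl-injective : Injective _≡_ _≡_ inl
  inl-injective = ↑ˡ-injective mB _ _

  inr-injective : Injective _≡_ _≡_ inr
  inr-injective = ↑ʳ-injective mA _ _

  inl≢inr : ∀ i j → inl i ≢ inr j
  inl≢inr i j e with trans (sym (splitAt-↑ˡ mA i mB)) (trans (cong (splitAt mA) e) (splitAt-↑ʳ mA mB j))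
  ... | ()

  data Side : Fin (mA + mB) → Set where
    left  : ∀ i → Side (inl i)
    right : ∀ j → Side (inr j)

  side : ∀ x → Side x
  side x = subst Side (join-splitAt mA mB x) (side-join (splitAt mA x))
    where side-join : ∀ s → Side (join mA mB s)
          side-join (inj₁ i) = left i
          side-join (inj₂ j) = right j

  bridge? : Fin mA → Fin mB → Bool
  bridge? i j = does (j ≟ aB) ∧ does (i ≟ bA)

  bridge-only : ∀ i j → bridge? i j ≡ true → i ≡ bA × j ≡ aB
  bridge-only i j e with j ≟ aB | i ≟ bA
  bridge-only i j e  | yes j≡ | yes i≡ = i≡ , j≡
  bridge-only i j () | yes _  | no _
  bridge-only i j () | no _   | _

  adj⊎ : Fin mA ⊎ Fin mB → Fin mA ⊎ Fin mB → Bool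
  adj⊎ (inj₁ i) (inj₁ i′) = adj TA i i′
  adj⊎ (inj₂ j) (inj₂ j′) = adj TB j j′
  adj⊎ (inj₁ i) (inj₂ j)  = bridge? i j
  adj⊎ (inj₂ j) (inj₁ i)  = bridge? i j

  G : FinGraph (mA + mB)
  G = record
    { adj     = λ x y → adj⊎ (splitAt mA x) (splitAt mA y)
    ; adj-sym = λ x y → sym⊎ (splitAt mA x) (splitAt mA y)
    ; adj-irr = λ x → irr⊎ (splitAt mA x) }
    where
      sym⊎ : ∀ s r → adj⊎ s r ≡ adj⊎ r s
      sym⊎ (inj₁ i) (inj₁ i′) = adj-sym TA i i′
      sym⊎ (inj₂ j) (inj₂ j′) = adj-sym TB j j′
      sym⊎ (inj₁ i) (inj₂ j)  = refl
      sym⊎ (inj₂ j) (inj₁ i)  = refl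
      irr⊎ : ∀ s → adj⊎ s s ≡ false
      irr⊎ (inj₁ i) = adj-irr TA i
      irr⊎ (inj₂ j) = adj-irr TB j

  adj-ll : ∀ i i′ → adj G (inl i) (inl i′) ≡ adj TA i i′
  adj-ll i i′ rewrite splitAt-↑ˡ mA i mB | splitAt-↑ˡ mA i′ mB = refl

  adj-rr : ∀ j j′ → adj G (inr j) (inr j′) ≡ adj TB j j′
  adj-rr j j′ rewrite splitAt-↑ʳ mA mB j | splitAt-↑ʳ mA mB j′ = refl

  adj-lr : ∀ i j → adj G (inl i) (inr j) ≡ bridge? i j
  adj-lr i j rewrite splitAt-↑ˡ mA i mB | splitAt-↑ʳ mA mB j = refl

  adj-rl : ∀ j i → adj G (inr j) (inl i) ≡ bridge? i j
  adj-rl j i rewrite splitAt-↑ˡ mA i mB | splitAt-↑ʳ mA mB j = refl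

  bridge : adj G (inl bA) (inr aB) ≡ true
  bridge = trans (adj-lr bA aB) (cong₂ _∧_ (dec-true (aB ≟ aB) refl) (dec-true (bA ≟ bA) refl))

  liftA : ∀ {i i′ p} → Walk TA i i′ p → Walk G (inl i) (inl i′) (map inl p)
  liftA = walk-map inl (λ {x} {y} e → trans (adj-ll x y) e)

  liftB : ∀ {j j′ p} → Walk TB j j′ p → Walk G (inr j) (inr j′) (map inr p)
  liftB = walk-map inr (λ {x} {y} e → trans (adj-rr x y) e)

  crossing-RL : ∀ {j y p} → Walk G (inr j) y p → ∀ {i} → y ≡ inl i → inl bA ∈ p
  crossing-RL here y≡ = ⊥-elim (inl≢inr _ _ (sym y≡))
  crossing-RL {j} (step {y = z} e w) y≡ with side z
  ... | right _ = there (crossing-RL w y≡)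
  ... | left i with bridge-only i j (trans (sym (adj-rl j i)) e)
  ...   | refl , _ = there (walk-start w)

  crossing-LR : ∀ {i y p} → Walk G (inl i) y p → ∀ {j} → y ≡ inr j → inr aB ∈ p
  crossing-LR here y≡ = ⊥-elim (inl≢inr _ _ y≡)
  crossing-LR {i} (step {y = z} e w) y≡ with side z
  ... | left _ = there (crossing-LR w y≡)
  ... | right j with bridge-only i j (trans (sym (adj-lr i j)) e)
  ...   | _ , refl = there (walk-start w)

  -- A path inside one side never uses the new edge, since it could not come back.
  walk-LL : ∀ {i y p} → Walk G (inl i) y p → Unique p → ∀ {i′} → y ≡ inl i′ →
    ∃ λ pA → Walk TA i i′ pA × p ≡ map inl pA
  walk-LL here _ y≡ with inl-injective y≡
  ... | refl = _ , here , refl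
  walk-LL {i} (step {y = z} e w) (i∉ ∷ u) y≡ with side z
  ... | left k = let (pA , wA , p≡) = walk-LL w u y≡
                 in i ∷ pA , step (trans (sym (adj-ll i k)) e) wA , cong (inl i ∷_) p≡
  ... | right j with bridge-only i j (trans (sym (adj-lr i j)) e)
  ...   | refl , refl = ⊥-elim (All.lookup i∉ (crossing-RL w y≡) refl)

  walk-RR : ∀ {j y p} → Walk G (inr j) y p → Unique p → ∀ {j′} → y ≡ inr j′ →
    ∃ λ pB → Walk TB j j′ pB × p ≡ map inr pB
  walk-RR here _ y≡ with inr-injective y≡
  ... | refl = _ , here , refl
  walk-RR {j} (step {y = z} e w) (j∉ ∷ u) y≡ with side z
  ... | right k = let (pB , wB , p≡) = walk-RR w u y≡
                  in j ∷ pB , step (trans (sym (adj-rr j k)) e) wB , cong (inr j ∷_) p≡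
  ... | left i with bridge-only i j (trans (sym (adj-rl j i)) e)
  ...   | refl , refl = ⊥-elim (All.lookup j∉ (crossing-LR w y≡) refl)

  walk-LR : ∀ {i y p} → Walk G (inl i) y p → Unique p → ∀ {j} → y ≡ inr j →
    ∃₂ λ pA pB → Walk TA i bA pA × Walk TB aB j pB × p ≡ map inl pA ++ map inr pB
  walk-LR here _ y≡ = ⊥-elim (inl≢inr _ _ y≡)
  walk-LR {i} (step {y = z} e w) (_ ∷ u) y≡ with side z
  ... | left k = let (pA , pB , wA , wB , p≡) = walk-LR w u y≡
                 in i ∷ pA , pB , step (trans (sym (adj-ll i k)) e) wA , wB , cong (inl i ∷_) p≡
  ... | right j with bridge-only i j (trans (sym (adj-lr i j)) e)
  ...   | refl , refl = let (pB , wB , p≡) = walk-RR w u y≡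
                        in bA ∷ [] , pB , here , wB , cong (inl bA ∷_) p≡

  walk-RL : ∀ {j y p} → Walk G (inr j) y p → Unique p → ∀ {i} → y ≡ inl i →
    ∃₂ λ pA pB → Walk TB j aB pB × Walk TA bA i pA × p ≡ map inr pB ++ map inl pA
  walk-RL here _ y≡ = ⊥-elim (inl≢inr _ _ (sym y≡))
  walk-RL {j} (step {y = z} e w) (_ ∷ u) y≡ with side z
  ... | right k = let (pA , pB , wB , wA , p≡) = walk-RL w u y≡
                  in pA , j ∷ pB , step (trans (sym (adj-rr j k)) e) wB , wA , cong (inr j ∷_) p≡
  ... | left i with bridge-only i j (trans (sym (adj-rl j i)) e)
  ...   | refl , refl = let (pA , wA , p≡) = walk-LL w u y≡
                        in pA , aB ∷ [] , here , wA , cong (inr aB ∷_) p≡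

  data Split (p : List (Fin (mA + mB))) (pA : List (Fin mA)) (pB : List (Fin mB)) : Set where
    A-first : p ≡ map inl pA ++ map inr pB → Split p pA pB
    B-first : p ≡ map inr pB ++ map inl pA → Split p pA pB

  split-unique : ∀ {p pA pB} → Split p pA pB → Unique p → Unique pA × Unique pB
  split-unique {pA = pA} (A-first refl) u =
    Unique.map⁻ (unique-++ˡ (map inl pA) u) , Unique.map⁻ (unique-++ʳ (map inl pA) u)
  split-unique {pB = pB} (B-first refl) u =
    Unique.map⁻ (unique-++ʳ (map inr pB) u) , Unique.map⁻ (unique-++ˡ (map inr pB) u)

  split-length : ∀ {p pA pB} → Split p pA pB → length p ≡ length pA + length pB
  split-length {pA = pA} {pB} (A-first refl) =
    trans (length-++ (map inl pA)) (cong₂ _+_ (length-map inl pA) (length-map inr pB))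
  split-length {pA = pA} {pB} (B-first refl) =
    trans (length-++ (map inr pB))
          (trans (cong₂ _+_ (length-map inr pB) (length-map inl pA)) (+-comm (length pB) _))

  split-∈ˡ : ∀ {q qA qB} → Split q qA qB → ∀ i → inl i ∈ q ⇔ i ∈ qA
  split-∈ˡ (A-first refl) _ = proj₁ (∈-blocks inl-injective inl≢inr)
  split-∈ˡ (B-first refl) _ = proj₂ (∈-blocks inl-injective inl≢inr)

  split-∈ʳ : ∀ {q qA qB} → Split q qA qB → ∀ j → inr j ∈ q ⇔ j ∈ qB
  split-∈ʳ (A-first refl) _ = proj₂ (∈-blocks inr-injective (λ j i → inl≢inr i j ∘ sym))
  split-∈ʳ (B-first refl) _ = proj₁ (∈-blocks inr-injective (λ j i → inl≢inr i j ∘ sym))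

  split-shared : ∀ {p pA pB q qA qB} → Split p pA pB → Split q qA qB →
    shared p q ≡ shared pA qA + shared pB qB
  split-shared {pA = pA} {pB} {q} {qA} {qB} (A-first refl) Q = begin
    shared (map inl pA ++ map inr pB) q
      ≡⟨ shared-++ (map inl pA) (map inr pB) q ⟩
    shared (map inl pA) q + shared (map inr pB) q
      ≡⟨ cong₂ _+_ (shared-map inl pA qA q (split-∈ˡ Q)) (shared-map inr pB qB q (split-∈ʳ Q)) ⟩
    shared pA qA + shared pB qB
      ∎
  split-shared {pA = pA} {pB} {q} {qA} {qB} (B-first refl) Q = begin
    shared (map inr pB ++ map inl pA) q
      ≡⟨ shared-++ (map inr pB) (map inl pA) q ⟩
    shared (map inr pB) q + shared (map inl pA) q
      ≡⟨ cong₂ _+_ (shared-map inr pB qB q (split-∈ʳ Q)) (shared-map inl pA qA q (split-∈ˡ Q)) ⟩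
    shared pB qB + shared pA qA
      ≡⟨ +-comm (shared pB qB) _ ⟩
    shared pA qA + shared pB qB
      ∎

  path-LL : ∀ {i i′ p} → IsPath G (inl i) (inl i′) p → ∃ λ pA → IsPath TA i i′ pA × Split p pA []
  path-LL (w , u) with walk-LL w u refl
  ... | pA , wA , p≡ = let S = A-first (trans p≡ (sym (++-identityʳ (map inl pA))))
                       in pA , (wA , proj₁ (split-unique S u)) , S

  path-RR : ∀ {j j′ p} → IsPath G (inr j) (inr j′) p → ∃ λ pB → IsPath TB j j′ pB × Split p [] pB
  path-RR (w , u) with walk-RR w u refl
  ... | pB , wB , p≡ = let S = B-first (trans p≡ (sym (++-identityʳ (map inr pB))))
                       in pB , (wB , proj₂ (split-unique S u)) , S

  path-LR : ∀ {i j p} → IsPath G (inl i) (inr j) p →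
    ∃₂ λ pA pB → IsPath TA i bA pA × IsPath TB aB j pB × Split p pA pB
  path-LR (w , u) with walk-LR w u refl
  ... | pA , pB , wA , wB , p≡ = let (uA , uB) = split-unique (A-first p≡) u
                                 in pA , pB , (wA , uA) , (wB , uB) , A-first p≡

  path-RL : ∀ {j i p} → IsPath G (inr j) (inl i) p →
    ∃₂ λ pA pB → IsPath TB j aB pB × IsPath TA bA i pA × Split p pA pB
  path-RL (w , u) with walk-RL w u refl
  ... | pA , pB , wB , wA , p≡ = let (uA , uB) = split-unique (B-first p≡) u
                                 in pA , pB , (wB , uB) , (wA , uA) , B-first p≡

  connected : Connected TA → Connected TB → Connected G
  connected connA connB x y with side x | side y
  ... | left i  | left i′  = _ , liftA (proj₂ (connA i i′))
  ... | right j | right j′ = _ , liftB (proj₂ (connB j j′))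
  ... | left i  | right j  = _ , walk-join (liftA (proj₂ (connA i bA))) bridge (liftB (proj₂ (connB aB j)))
  ... | right j | left i   = _ , walk-join (liftB (proj₂ (connB j aB)))
                                           (trans (adj-sym G (inr aB) (inl bA)) bridge)
                                           (liftA (proj₂ (connA bA i)))

  -- A cycle through the new edge would consist of the trivial paths at its ends.
  acyclic : Acyclic TA → Acyclic TB → Acyclic G
  acyclic acycA acycB x y p path len yx with side x | side y
  ... | left i | left i′ =
    let (pA , pathA , S) = path-LL path
    in acycA i i′ pA pathA (subst (_≥ 3) (trans (split-length S) (+-identityʳ _)) len)
                           (trans (sym (adj-ll i′ i)) yx)
  ... | right j | right j′ =
    let (pB , pathB , S) = path-RR path
    in acycB j j′ pB pathB (subst (_≥ 3) (split-length S) len) (trans (sym (adj-rr j′ j)) yx)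
  ... | left i | right j with bridge-only i j (trans (sym (adj-rl j i)) yx)
  ...   | refl , refl with path-LR path
  ...     | _ , _ , pathA , pathB , S
    rewrite split-length S | path-closed pathA | path-closed pathB with len
  ...       | s≤s (s≤s ())
  acyclic acycA acycB x y p path len yx | right j | left i with bridge-only i j (trans (sym (adj-lr i j)) yx)
  ...   | refl , refl with path-RL path
  ...     | _ , _ , pathB , pathA , S
    rewrite split-length S | path-closed pathA | path-closed pathB with len
  ...       | s≤s (s≤s ())

  isTree : IsTree TA → IsTree TB → IsTree G
  isTree (connA , acycA) (connB , acycB) = connected connA connB , acyclic acycA acycB

  degree-inl : ∀ i → degree G (inl i) ≡ degree TA i + bit (does (i ≟ bA))
  degree-inl i = begin
    degree G (inl i)
      ≡⟨ degree-count G (inl i) ⟩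
    count (adj G (inl i))
      ≡⟨ count-↑ {mA} (adj G (inl i)) ⟩
    count (λ k → adj G (inl i) (inl k)) + count (λ j → adj G (inl i) (inr j))
      ≡⟨ cong₂ _+_ (count-cong (adj-ll i)) (count-cong (adj-lr i)) ⟩
    count (adj TA i) + count (λ j → does (j ≟ aB) ∧ does (i ≟ bA))
      ≡⟨ cong₂ _+_ (sym (degree-count TA i)) (count-point aB (does (i ≟ bA))) ⟩
    degree TA i + bit (does (i ≟ bA))
      ∎

  degree-inr : ∀ j → degree G (inr j) ≡ degree TB j + bit (does (j ≟ aB))
  degree-inr j = begin
    degree G (inr j)
      ≡⟨ degree-count G (inr j) ⟩
    count (adj G (inr j))
      ≡⟨ count-↑ {mA} (adj G (inr j)) ⟩
    count (λ i → adj G (inr j) (inl i)) + count (λ k → adj G (inr j) (inr k))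
      ≡⟨ cong₂ _+_ (count-cong (λ i → trans (adj-rl j i) (∧-comm (does (j ≟ aB)) _)))
                   (count-cong (adj-rr j)) ⟩
    count (λ i → does (i ≟ bA) ∧ does (j ≟ aB)) + count (adj TB j)
      ≡⟨ cong₂ _+_ (count-point bA (does (j ≟ aB))) (sym (degree-count TB j)) ⟩
    bit (does (j ≟ aB)) + degree TB j
      ≡⟨ +-comm (bit (does (j ≟ aB))) _ ⟩
    degree TB j + bit (does (j ≟ aB))
      ∎

  -- A vertex of degree d ≤ h gains at most one neighbour, and only if it was a
  -- leaf; as 2 ≤ h its degree stays within h.
  private
    degree-bound : ∀ {h d} {P : Set} (P? : Dec P) → d ≤ h → (P → d ≤ 1) → 2 ≤ h → d + bit (does P?) ≤ h
    degree-bound {d = d} (no _)  d≤h _    _   = subst (_≤ _) (sym (+-identityʳ d)) d≤h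
    degree-bound         (yes p) _   leaf 2≤h = ≤-trans (+-monoˡ-≤ 1 (leaf p)) 2≤h

  maxDegree : ∀ {h} → (∀ i → degree TA i ≤ h) → (∀ j → degree TB j ≤ h) →
    IsLeaf TA bA → IsLeaf TB aB → 2 ≤ h → ∀ v → degree G v ≤ h
  maxDegree maxA maxB leafA leafB 2≤h v with side v
  ... | left i  = subst (_≤ _) (sym (degree-inl i))
                    (degree-bound (i ≟ bA) (maxA i) (λ { refl → leafA }) 2≤h)
  ... | right j = subst (_≤ _) (sym (degree-inr j))
                    (degree-bound (j ≟ aB) (maxB j) (λ { refl → leafB }) 2≤h)

  private
    leaf-gain : ∀ {d} {P : Set} (P? : Dec P) → (P → 1 ≤ d) → (d + bit (does P?) ≤ 1) ⇔ (d ≤ 1 × ¬ P)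
    leaf-gain {d} (no ¬p) _  = mk⇔ (λ l → subst (_≤ 1) (+-identityʳ d) l , ¬p)
                                   (λ (l , _) → subst (_≤ 1) (sym (+-identityʳ d)) l)
    leaf-gain     (yes p) pos = mk⇔ (λ l → ⊥-elim (2≰1 (≤-trans (+-monoˡ-≤ 1 (pos p)) l)))
                                    (λ (_ , ¬p) → ⊥-elim (¬p p))
      where 2≰1 : ¬ (2 ≤ 1)
            2≰1 (s≤s ())

  leaf-inl : 1 ≤ degree TA bA → ∀ i → IsLeaf G (inl i) ⇔ (IsLeaf TA i × i ≢ bA)
  leaf-inl pos i = subst (λ d → (d ≤ 1) ⇔ _) (sym (degree-inl i)) (leaf-gain (i ≟ bA) (λ { refl → pos }))

  leaf-inr : 1 ≤ degree TB aB → ∀ j → IsLeaf G (inr j) ⇔ (IsLeaf TB j × j ≢ aB)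
  leaf-inr pos j = subst (λ d → (d ≤ 1) ⇔ _) (sym (degree-inr j)) (leaf-gain (j ≟ aB) (λ { refl → pos }))

Apart : ∀ {V : Set} → V → V → V → V → Set
Apart x y x′ y′ = x ≢ x′ × x ≢ y′ × y ≢ x′ × y ≢ y′

module Projection {V : Set} (H : Graph V) (π : V → V) where

  Faithful : Set
  Faithful = ∀ {z w z′ w′} → E H z w → E H (π z) (π w) → E H z′ w′ → E H (π z′) (π w′) →
             π z ≡ π z′ → z ≡ z′ ⊎ w ≡ w′

  faithful-apart : Faithful → ∀ {x y x′ y′} → E H x y → E H x′ y′ → Apart x y x′ y′ →
    E H (π x) (π y) → E H (π x′) (π y′) → Apart (π x) (π y) (π x′) (π y′)
  faithful-apart faithful e e′ (d₁ , d₂ , d₃ , d₄) πe πe′ =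
      (λ eq → [ d₁ , d₄ ]′ (faithful e πe e′ πe′ eq))
    , (λ eq → [ d₂ , d₃ ]′ (faithful e πe (E-sym H e′) (E-sym H πe′) eq))
    , (λ eq → [ d₃ , d₂ ]′ (faithful (E-sym H e) (E-sym H πe) e′ πe′ eq))
    , (λ eq → [ d₄ , d₁ ]′ (faithful (E-sym H e) (E-sym H πe) (E-sym H e′) (E-sym H πe′) eq))

-- What a path of a glued tree between the ends of an edge xy of H leaves in one
-- side, laid out by L: either nothing, or a path of L's tree between the images
-- of the projected ends π x and π y, which form an edge of H.
module SidePart {h t : ℕ} {V : Set} {H : Graph V} {Y : V → Bool}
  (L : TreeLayout h t (induced H Y)) (π : V → V) where
  open TreeLayout L

  data Part (x y : V) : List (Fin m) → Set where
    absent  : Part x y []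
    present : ∀ {l} (u v : Σ V (T ∘ Y)) → proj₁ u ≡ π x → proj₁ v ≡ π y →
              E H (proj₁ u) (proj₁ v) → IsPath tree (f u) (f v) l → Part x y l

  part-shared : ∀ {x y x′ y′ l l′} → Part x y l → Part x′ y′ l′ →
    (E H (π x) (π y) → E H (π x′) (π y′) → Apart (π x) (π y) (π x′) (π y′)) →
    shared l l′ ≤ t ∸ 1
  part-shared absent _ _ = z≤n
  part-shared {l = l} (present _ _ _ _ _ _) absent _ = subst (_≤ t ∸ 1) (sym (shared-[]ʳ l)) z≤n
  part-shared (present u@(_ , _) v@(_ , _) refl refl e P) (present u′@(_ , _) v′@(_ , _) refl refl e′ P′) apart =
    let (d₁ , d₂ , d₃ , d₄) = apart e e′
    in layout u v u′ v′ e e′ (d₁ ∘ cong proj₁) (d₂ ∘ cong proj₁) (d₃ ∘ cong proj₁) (d₄ ∘ cong proj₁) _ _ P P′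

module Gluing {n : ℕ} (H : Graph (Fin n)) (A : Fin n → Bool) {a b : Fin n}
  (Aa : A a ≡ true) (Ab : A b ≡ false)
  (cross : ∀ x y → E H x y → A x ≡ true → A y ≡ false → x ≡ a ⊎ y ≡ a)
  (ab : E H a b) {h t : ℕ} (2≤h : 2 ≤ h)
  (LA : TreeLayout h t (induced H (λ v → A v ∨ ⌊ v ≟ b ⌋)))
  (LB : TreeLayout h t (induced H (λ v → not (A v) ∨ ⌊ v ≟ a ⌋))) where

  private
    module LA = TreeLayout LA
    module LB = TreeLayout LB

  YA YB : Fin n → Bool
  YA v = A v ∨ ⌊ v ≟ b ⌋
  YB v = not (A v) ∨ ⌊ v ≟ a ⌋

  inA : ∀ {x} → A x ≡ true → T (YA x)
  inA Ax = Equivalence.from T-∨ (inj₁ (Equivalence.from T-≡ Ax))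

  inB : ∀ {x} → A x ≡ false → T (YB x)
  inB Ax = Equivalence.from T-∨ (inj₁ (Equivalence.from T-not-≡ Ax))

  inA⁻ : ∀ {x} → T (YA x) → x ≢ b → A x ≡ true
  inA⁻ x∈ x≢b = [ Equivalence.to T-≡ , ⊥-elim ∘ x≢b ∘ toWitness ]′ (Equivalence.to T-∨ x∈)

  inB⁻ : ∀ {x} → T (YB x) → x ≢ a → A x ≡ false
  inB⁻ x∈ x≢a = [ Equivalence.to T-not-≡ , ⊥-elim ∘ x≢a ∘ toWitness ]′ (Equivalence.to T-∨ x∈)

  A-differ : ∀ {x y} → A x ≡ true → A y ≡ false → A x ≢ A y
  A-differ Ax Ay eq with trans (sym Ax) (trans eq Ay)
  ... | ()

  A-apart : ∀ {x y} → A x ≡ true → A y ≡ false → x ≢ y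
  A-apart Ax Ay = A-differ Ax Ay ∘ cong A

  bᴬ : Σ (Fin n) (T ∘ YA)
  bᴬ = b , Equivalence.from (T-∨ {A b}) (inj₂ (fromWitness {a? = b ≟ b} refl))

  aᴮ : Σ (Fin n) (T ∘ YB)
  aᴮ = a , Equivalence.from (T-∨ {not (A a)}) (inj₂ (fromWitness {a? = a ≟ a} refl))

  open Glue LA.tree LB.tree (LA.f bᴬ) (LB.f aᴮ)

  place : ∀ x β → A x ≡ β → Fin (LA.m + LB.m)
  place x true  Ax = inl (LA.f (x , inA Ax))
  place x false Ax = inr (LB.f (x , inB Ax))

  fG : Fin n → Fin (LA.m + LB.m)
  fG x = place x (A x) refl

  data Placed (x : Fin n) : Fin (LA.m + LB.m) → Set where
    placedA : (Ax : A x ≡ true)  → Placed x (inl (LA.f (x , inA Ax)))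
    placedB : (Ax : A x ≡ false) → Placed x (inr (LB.f (x , inB Ax)))

  placed : ∀ x → Placed x (fG x)
  placed x = placed′ (A x) refl
    where placed′ : ∀ β (Ax : A x ≡ β) → Placed x (place x β Ax)
          placed′ true  Ax = placedA Ax
          placed′ false Ax = placedB Ax

  fG-injective : Injective _≡_ _≡_ fG
  fG-injective {x} {y} e with fG x | placed x | fG y | placed y
  ... | _ | placedA _ | _ | placedA _ = cong proj₁ (LA.f-inj (inl-injective e))
  ... | _ | placedB _ | _ | placedB _ = cong proj₁ (LB.f-inj (inr-injective e))
  ... | _ | placedA _ | _ | placedB _ = ⊥-elim (inl≢inr _ _ e)
  ... | _ | placedB _ | _ | placedA _ = ⊥-elim (inl≢inr _ _ (sym e))

  -- The ends of the new edge are not isolated in their trees, since each tree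
  -- has another leaf (the image of a, resp. b).
  bA-degree : 1 ≤ degree LA.tree (LA.f bᴬ)
  bA-degree = degree-≥1 LA.tree (proj₂ (has-neighbour (proj₁ LA.isTree) {y = LA.f (a , inA Aa)}
                                         (A-apart Aa Ab ∘ sym ∘ cong proj₁ ∘ LA.f-inj)))

  aB-degree : 1 ≤ degree LB.tree (LB.f aᴮ)
  aB-degree = degree-≥1 LB.tree (proj₂ (has-neighbour (proj₁ LB.isTree) {y = LB.f (b , inB Ab)}
                                         (A-apart Aa Ab ∘ cong proj₁ ∘ LB.f-inj)))

  fG-leaf : ∀ x → IsLeaf G (fG x)
  fG-leaf x with fG x | placed x
  ... | _ | placedA Ax = Equivalence.from (leaf-inl bA-degree _)
                       (LA.f-leaf _ , A-apart Ax Ab ∘ cong proj₁ ∘ LA.f-inj)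
  ... | _ | placedB Ax = Equivalence.from (leaf-inr aB-degree _)
                       (LB.f-leaf _ , A-apart Aa Ax ∘ sym ∘ cong proj₁ ∘ LB.f-inj)

  fG-inl : ∀ {x} (Ax : A x ≡ true) → fG x ≡ inl (LA.f (x , inA Ax))
  fG-inl {x} Ax with fG x | placed x
  ... | _ | placedA _   = cong (inl ∘ LA.f) (subtype-≡ refl)
  ... | _ | placedB Ax′ = ⊥-elim (A-apart Ax Ax′ refl)

  fG-inr : ∀ {x} (Ax : A x ≡ false) → fG x ≡ inr (LB.f (x , inB Ax))
  fG-inr {x} Ax with fG x | placed x
  ... | _ | placedB _   = cong (inr ∘ LB.f) (subtype-≡ refl)
  ... | _ | placedA Ax′ = ⊥-elim (A-apart Ax′ Ax refl)

  -- Every leaf of the glued tree is a leaf of its own tree other than the end of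
  -- the new edge, hence the image of a vertex of the right part.
  fG-onto : ∀ u → IsLeaf G u → ∃ λ x → fG x ≡ u
  fG-onto u leaf with side u
  ... | left i with Equivalence.to (leaf-inl bA-degree i) leaf
  ...   | leafA , i≢bA with LA.f-onto i leafA
  ...     | (x , x∈) , refl =
    let Ax = inA⁻ x∈ (i≢bA ∘ cong LA.f ∘ subtype-≡) in
    x , trans (fG-inl Ax) (cong (inl ∘ LA.f) (subtype-≡ refl))
  fG-onto u leaf | right j with Equivalence.to (leaf-inr aB-degree j) leaf
  ...   | leafB , j≢aB with LB.f-onto j leafB
  ...     | (x , x∈) , refl =
    let Ax = inB⁻ x∈ (j≢aB ∘ cong LB.f ∘ subtype-≡) in
    x , trans (fG-inr Ax) (cong (inr ∘ LB.f) (subtype-≡ refl))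

  πA πB : Fin n → Fin n
  πA z = if A z then z else b
  πB z = if A z then a else z

  πA-in : ∀ {z} → A z ≡ true → πA z ≡ z
  πA-in Az rewrite Az = refl

  πA-out : ∀ {z} → A z ≡ false → πA z ≡ b
  πA-out Az rewrite Az = refl

  πB-in : ∀ {z} → A z ≡ true → πB z ≡ a
  πB-in Az rewrite Az = refl

  πB-out : ∀ {z} → A z ≡ false → πB z ≡ z
  πB-out Az rewrite Az = refl

  A? : ∀ z → A z ≡ true ⊎ A z ≡ false
  A? z with A z
  ... | true  = inj₁ refl
  ... | false = inj₂ refl

  crossing-end : ∀ {x y} → E H x y → A x ≢ A y → x ≡ a ⊎ y ≡ a
  crossing-end {x} {y} e Ax≢Ay with A? x | A? y
  ... | inj₁ Ax | inj₂ Ay = cross x y e Ax Ay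
  ... | inj₂ Ax | inj₁ Ay = swap (cross y x (E-sym H e) Ay Ax)
  ... | inj₁ Ax | inj₁ Ay = ⊥-elim (Ax≢Ay (trans Ax (sym Ay)))
  ... | inj₂ Ax | inj₂ Ay = ⊥-elim (Ax≢Ay (trans Ax (sym Ay)))

  not-both-crossing : ∀ {x y x′ y′} → E H x y → E H x′ y′ → Apart x y x′ y′ → A x ≡ A y ⊎ A x′ ≡ A y′
  not-both-crossing {x} {y} {x′} {y′} e e′ (d₁ , d₂ , d₃ , d₄)
    with A x ≟ᵇ A y | A x′ ≟ᵇ A y′
  ... | yes eq | _      = inj₁ eq
  ... | no _   | yes eq = inj₂ eq
  ... | no ne  | no ne′ with crossing-end e ne | crossing-end e′ ne′
  ...   | inj₁ refl | inj₁ x′≡a = ⊥-elim (d₁ (sym x′≡a))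
  ...   | inj₁ refl | inj₂ y′≡a = ⊥-elim (d₂ (sym y′≡a))
  ...   | inj₂ refl | inj₁ x′≡a = ⊥-elim (d₃ (sym x′≡a))
  ...   | inj₂ refl | inj₂ y′≡a = ⊥-elim (d₄ (sym y′≡a))

  partner-a : ∀ {z w} → E H z w → E H (πA z) (πA w) → A z ≡ false → w ≡ a
  partner-a {z} {w} e πe Az with A? w
  ... | inj₂ Aw = ⊥-elim (E-irr H (subst₂ (E H) (πA-out Az) (πA-out Aw) πe))
  ... | inj₁ Aw with cross w z (E-sym H e) Aw Az
  ...   | inj₁ w≡a = w≡a
  ...   | inj₂ z≡a = ⊥-elim (A-apart Aa Az (sym z≡a))

  end-a : ∀ {z w} → E H z w → E H (πB z) (πB w) → A z ≡ true → z ≡ a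
  end-a {z} {w} e πe Az with A? w
  ... | inj₁ Aw = ⊥-elim (E-irr H (subst₂ (E H) (πB-in Az) (πB-in Aw) πe))
  ... | inj₂ Aw with cross z w e Az Aw
  ...   | inj₁ z≡a = z≡a
  ...   | inj₂ w≡a = ⊥-elim (A-apart Aa Aw (sym w≡a))

  faithfulA : Projection.Faithful H πA
  faithfulA {z} {w} {z′} {w′} e πe e′ πe′ eq with A? z | A? z′
  ... | inj₁ Az | inj₁ Az′ = inj₁ (trans (sym (πA-in Az)) (trans eq (πA-in Az′)))
  ... | inj₁ Az | inj₂ Az′ = ⊥-elim (A-apart Az Ab (trans (sym (πA-in Az)) (trans eq (πA-out Az′))))
  ... | inj₂ Az | inj₁ Az′ = ⊥-elim (A-apart Az′ Ab (trans (sym (πA-in Az′)) (trans (sym eq) (πA-out Az))))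
  ... | inj₂ Az | inj₂ Az′ = inj₂ (trans (partner-a e πe Az) (sym (partner-a e′ πe′ Az′)))

  faithfulB : Projection.Faithful H πB
  faithfulB {z} {w} {z′} {w′} e πe e′ πe′ eq with A? z | A? z′
  ... | inj₂ Az | inj₂ Az′ = inj₁ (trans (sym (πB-out Az)) (trans eq (πB-out Az′)))
  ... | inj₂ Az | inj₁ Az′ = ⊥-elim (A-apart Aa Az (sym (trans (sym (πB-out Az)) (trans eq (πB-in Az′)))))
  ... | inj₁ Az | inj₂ Az′ = ⊥-elim (A-apart Aa Az′ (sym (trans (sym (πB-out Az′)) (trans (sym eq) (πB-in Az)))))
  ... | inj₁ Az | inj₁ Az′ = inj₁ (trans (end-a e πe Az) (sym (end-a e′ πe′ Az′)))

  open SidePart LA πA using () renaming (Part to PartA; absent to absentA; present to presentA; part-shared to part-sharedA)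
  open SidePart LB πB using () renaming (Part to PartB; absent to absentB; present to presentB; part-shared to part-sharedB)

  record View (x y : Fin n) (p : List (Fin (LA.m + LB.m))) : Set where
    field
      pA        : List (Fin LA.m)
      pB        : List (Fin LB.m)
      split     : Split p pA pB
      partA     : PartA x y pA
      partB     : PartB x y pB
      one-sided : A x ≡ A y → pA ≡ [] ⊎ pB ≡ []

  view : ∀ {x y p} → E H x y → IsPath G (fG x) (fG y) p → View x y p
  view {x} {y} e path with fG x | placed x | fG y | placed y
  ... | _ | placedA Ax | _ | placedA Ay =
    let (pA , PA , S) = path-LL path in record
      { split = S ; one-sided = λ _ → inj₂ refl ; partB = absentB
      ; partA = presentA (x , inA Ax) (y , inA Ay) (sym (πA-in Ax)) (sym (πA-in Ay)) e PA }
  ... | _ | placedB Ax | _ | placedB Ay =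
    let (pB , PB , S) = path-RR path in record
      { split = S ; one-sided = λ _ → inj₁ refl ; partA = absentA
      ; partB = presentB (x , inB Ax) (y , inB Ay) (sym (πB-out Ax)) (sym (πB-out Ay)) e PB }
  ... | _ | placedA Ax | _ | placedB Ay with crossing-end e (A-differ Ax Ay)
  ...   | inj₂ y≡a = ⊥-elim (A-apart Aa Ay (sym y≡a))
  ...   | inj₁ refl =
    let (pA , pB , PA , PB , S) = path-LR path in record
      { split = S ; one-sided = ⊥-elim ∘ A-differ Ax Ay
      ; partA = presentA (a , inA Ax) bᴬ (sym (πA-in Ax)) (sym (πA-out Ay)) ab PA
      ; partB = presentB aᴮ (y , inB Ay) (sym (πB-in Ax)) (sym (πB-out Ay)) e PB }
  view {x} {y} e path | _ | placedB Ax | _ | placedA Ay with crossing-end e (A-differ Ay Ax ∘ sym)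
  ...   | inj₁ x≡a = ⊥-elim (A-apart Aa Ax (sym x≡a))
  ...   | inj₂ refl =
    let (pA , pB , PB , PA , S) = path-RL path in record
      { split = S ; one-sided = ⊥-elim ∘ A-differ Ay Ax ∘ sym
      ; partA = presentA bᴬ (a , inA Ay) (sym (πA-out Ax)) (sym (πA-in Ay)) (E-sym H ab) PA
      ; partB = presentB (x , inB Ax) aᴮ (sym (πB-out Ax)) (sym (πB-in Ay)) e PB }

  one-side-empty : ∀ {x y x′ y′ p q} (V : View x y p) (V′ : View x′ y′ q) →
    A x ≡ A y ⊎ A x′ ≡ A y′ →
    (View.pA V ≡ [] ⊎ View.pA V′ ≡ []) ⊎ (View.pB V ≡ [] ⊎ View.pB V′ ≡ [])
  one-side-empty V V′ (inj₁ eq) with View.one-sided V eq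
  ... | inj₁ empty = inj₁ (inj₁ empty)
  ... | inj₂ empty = inj₂ (inj₁ empty)
  one-side-empty V V′ (inj₂ eq) with View.one-sided V′ eq
  ... | inj₁ empty = inj₁ (inj₂ empty)
  ... | inj₂ empty = inj₂ (inj₂ empty)

  -- The shared vertices are counted on the two sides; each side is bounded by
  -- its layout, and one side contributes nothing.
  separated : Separated t H G fG
  separated x y x′ y′ e e′ d₁ d₂ d₃ d₄ p q P Q =
    subst (_≤ t ∸ 1) (sym (split-shared (View.split V) (View.split V′)))
      (sum-bound
        (part-sharedA (View.partA V) (View.partA V′) (Projection.faithful-apart H πA faithfulA e e′ apart))
        (part-sharedB (View.partB V) (View.partB V′) (Projection.faithful-apart H πB faithfulB e e′ apart))
        (⊎-map shared-empty shared-empty (one-side-empty V V′ (not-both-crossing e e′ apart))))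
    where
      V = view e P
      V′ = view e′ Q
      apart = d₁ , d₂ , d₃ , d₄

  glued : TreeLayout h t H
  glued = record
    { m = LA.m + LB.m ; tree = G
    ; isTree = isTree LA.isTree LB.isTree
    ; maxDeg = maxDegree LA.maxDeg LB.maxDeg (LA.f-leaf bᴬ) (LB.f-leaf aᴮ) 2≤h
    ; f = fG ; f-inj = fG-injective ; f-leaf = fG-leaf ; f-onto = fG-onto
    ; layout = separated }

lemma2 : (n : ℕ) (H : Graph (Fin n)) (A : Fin n → Bool) (a b : Fin n) →
    A a ≡ true → A b ≡ false →
    (∀ x y → E H x y → A x ≡ true → A y ≡ false → x ≡ a ⊎ y ≡ a) →
    E H a b →
    (h t : ℕ) → h ≥ 3 → t ≥ 1 →
    HasTreeLayout h t H ⇔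
      (HasTreeLayout h t (induced H (λ v → A v ∨ ⌊ v ≟ b ⌋)) ×
       HasTreeLayout h t (induced H (λ v → not (A v) ∨ ⌊ v ≟ a ⌋)))
lemma2 n H A a b Aa Ab cross ab h t h≥3 _ = mk⇔
  (λ L → restrict searchable-Fin _ L , restrict searchable-Fin _ L)
  (λ (LA , LB) → Gluing.glued H A Aa Ab cross ab (≤-trans (s≤s (s≤s z≤n)) h≥3) LA LB)
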